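{- For all formulas $\varphi,\psi,\chi$: (1) both sequents $(\varphi\rightarrow\psi)\wedge\varphi\blacktriangleright\varphi\wedge\psi$ and $\varphi\wedge\psi\blacktriangleright(\varphi\rightarrow\psi)\wedge\varphi$ are derivable in $\mathtt{CHC}$; (2) $\varphi\rightarrow\psi\blacktriangleright(\varphi\wedge\chi)\rightarrow(\psi\wedge\chi)$ is derivable in $\mathtt{CHC}$; (3) $\varphi\rightarrow\psi\blacktriangleright(\varphi\vee\chi)\rightarrow(\psi\vee\chi)$ is derivable in $\mathtt{CHC}$.
   Context: Formulas are built from variables with binary $\wedge,\vee,\rightarrow$ and constants $0,1$; $\neg\alpha:=\alpha\rightarrow 0$. A sequent $\Gamma\blacktriangleright\Pi$ is a pair of a finite set $\Gamma$ of formulas and a set $\Pi$ that is empty or a singleton; commas denote union. $\mathtt{CHC}$ has axioms (id) $\alpha\blacktriangleright\alpha$; (0) $0\blacktriangleright$; (1) $\blacktriangleright 1$; rules (w-l) $\Gamma\blacktriangleright\Pi/\alpha,\Gamma\blacktriangleright\Pi$; (w-r) $\Gamma\blacktriangleright/\Gamma\blacktriangleright\alpha$; (cut) $\Gamma\blacktriangleright\alpha$, $\alpha,\Delta\blacktriangleright\Pi/\Gamma,\Delta\blacktriangleright\Pi$; ($\wedge$-l) $\alpha,\Gamma\blacktriangleright\Pi/\alpha\wedge\beta,\Gamma\blacktriangleright\Pi$ and $\beta,\Gamma\blacktriangleright\Pi/\alpha\wedge\beta,\Gamma\blacktriangleright\Pi$; ($\wedge$-r) $\Gamma\blacktriangleright\alpha$,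 $\Gamma\blacktriangleright\beta/\Gamma\blacktriangleright\alpha\wedge\beta$; ($\vee$-r) $\Gamma\blacktriangleright\alpha/\Gamma\blacktriangleright\alpha\vee\beta$ and $\Gamma\blacktriangleright\beta/\Gamma\blacktriangleright\alpha\vee\beta$; ($\vee$-l) $\alpha,\Gamma\blacktriangleright\Pi$, $\beta,\Gamma\blacktriangleright\Pi/\alpha\vee\beta,\Gamma\blacktriangleright\Pi$; ($\rightarrow$-l(a)) $\Gamma\blacktriangleright\alpha$, $\Delta,\beta\blacktriangleright\Pi/\Delta,\Gamma,\alpha\rightarrow\beta\blacktriangleright\Pi$; ($\rightarrow$-l(b)) $\neg\alpha,\Gamma\blacktriangleright\beta$, $\Delta,\alpha,\beta\blacktriangleright/\Gamma,\Delta,\alpha\rightarrow\beta\blacktriangleright$; ($\rightarrow$-r) $\alpha,\Gamma\blacktriangleright\beta$, $\Delta,\neg\alpha,\beta\blacktriangleright/\Gamma,\Delta\blacktriangleright\alpha\rightarrow\beta$. -}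

module Defs where

open import Data.Nat using (ℕ)
open import Data.List using (List; []; _∷_; _++_)
open import Data.List.Membership.Propositional using (_∈_)
open import Data.Maybe using (Maybe; just; nothing)

data Fm : Set where
  var  : ℕ → Fm
  ⊥'   : Fm
  ⊤'   : Fm
  _∧'_ : Fm → Fm → Fm
  _∨'_ : Fm → Fm → Fm
  _⇒_  : Fm → Fm → Fm

infixr 6 _∧'_
infixr 5 _∨'_
infixr 4 _⇒_

¬' : Fm → Fm
¬' a = a ⇒ ⊥'

-- Finite sets of formulas are represented by lists, taken up to having the
-- same elements (rule 'set-eq' below); comma (union) is list append.
-- The succedent Π is empty ('nothing') or a singleton ('just α').
SameSet : List Fm → List Fm → Set
SameSet Γ Δ = (∀ {a} → a ∈ Γ → a ∈ Δ) × (∀ {a} → a ∈ Δ → a ∈ Γ)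
  where open import Data.Product using (_×_)

infix 2 _▸_
data _▸_ : List Fm → Maybe Fm → Set where
  set-eq : ∀ {Γ Γ' Π} → SameSet Γ Γ' → Γ ▸ Π → Γ' ▸ Π
  ax-id  : ∀ {a} → (a ∷ []) ▸ just a
  ax-0   : (⊥' ∷ []) ▸ nothing
  ax-1   : [] ▸ just ⊤'
  w-l    : ∀ {a Γ Π} → Γ ▸ Π → (a ∷ Γ) ▸ Π
  w-r    : ∀ {a Γ} → Γ ▸ nothing → Γ ▸ just a
  cut    : ∀ {a Γ Δ Π} → Γ ▸ just a → (a ∷ Δ) ▸ Π → (Γ ++ Δ) ▸ Π
  ∧-l₁   : ∀ {a b Γ Π} → (a ∷ Γ) ▸ Π → ((a ∧' b) ∷ Γ) ▸ Π
  ∧-l₂   : ∀ {a b Γ Π} → (b ∷ Γ) ▸ Π → ((a ∧' b) ∷ Γ) ▸ Π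
  ∧-r    : ∀ {a b Γ} → Γ ▸ just a → Γ ▸ just b → Γ ▸ just (a ∧' b)
  ∨-r₁   : ∀ {a b Γ} → Γ ▸ just a → Γ ▸ just (a ∨' b)
  ∨-r₂   : ∀ {a b Γ} → Γ ▸ just b → Γ ▸ just (a ∨' b)
  ∨-l    : ∀ {a b Γ Π} → (a ∷ Γ) ▸ Π → (b ∷ Γ) ▸ Π → ((a ∨' b) ∷ Γ) ▸ Π
  ⇒-la   : ∀ {a b Γ Δ Π} → Γ ▸ just a → (b ∷ Δ) ▸ Π
         → ((a ⇒ b) ∷ (Δ ++ Γ)) ▸ Π
  ⇒-lb   : ∀ {a b Γ Δ} → (¬' a ∷ Γ) ▸ just b → (a ∷ b ∷ Δ) ▸ nothing
         → ((a ⇒ b) ∷ (Γ ++ Δ)) ▸ nothing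
  ⇒-r    : ∀ {a b Γ Δ} → (a ∷ Γ) ▸ just b → (¬' a ∷ b ∷ Δ) ▸ nothing
         → (Γ ++ Δ) ▸ just (a ⇒ b)

-- CHC proves the usual natural-deduction rules for ∧, ∨ and modus ponens,
-- since weakening, the set reading of contexts and cut let every rule act on
-- a shared context. Only →-introduction is unusual: besides α, Γ ▸ β it needs
-- a refutation of ¬α, β, Γ. For the first and third sequents the premise
-- ¬α meets α directly; for the implications φ ∧ χ ⇒ ψ ∧ χ and
-- φ ∨ χ ⇒ ψ ∨ χ, rule →-l(b) on the hypothesis φ → ψ reduces the refutation
-- to the case where φ and ψ hold, where ¬α meets the formula α built from them.
module Submission where

open import Defs
open import Data.List using (List; []; _∷_; _++_)
open import Data.Maybe using (just; nothing)
open import Data.Product using (_×_; _,_)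
open import Data.Sum using (inj₁; inj₂)
open import Data.List.Membership.Propositional using (_∈_)
open import Data.List.Membership.Propositional.Properties using (∈-++⁻; ∈-++⁺ˡ)
open import Data.List.Relation.Unary.Any using (here; there)
open import Relation.Binary.PropositionalEquality using (refl)

_⊆_ : List Fm → List Fm → Set
Γ ⊆ Δ = ∀ {a} → a ∈ Γ → a ∈ Δ

++-idem-⊆ : {Γ : List Fm} → (Γ ++ Γ) ⊆ Γ
++-idem-⊆ {Γ} m with ∈-++⁻ Γ m
... | inj₁ m′ = m′
... | inj₂ m′ = m′

weaken-++ : ∀ {Γ Π} (Δ : List Fm) → Γ ▸ Π → (Δ ++ Γ) ▸ Π
weaken-++ []      p = p
weaken-++ (_ ∷ Δ) p = w-l (weaken-++ Δ p)

weaken-⊆ : ∀ {Γ Δ Π} → Γ ⊆ Δ → Γ ▸ Π → Δ ▸ Π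
weaken-⊆ {Γ} {Δ} Γ⊆Δ p = set-eq (absorb , ∈-++⁺ˡ) (weaken-++ Δ p)
  where
  absorb : (Δ ++ Γ) ⊆ Δ
  absorb m with ∈-++⁻ Δ m
  ... | inj₁ m′ = m′
  ... | inj₂ m′ = Γ⊆Δ m′

assumption : ∀ {Γ a} → a ∈ Γ → Γ ▸ just a
assumption a∈Γ = weaken-⊆ (λ { (here refl) → a∈Γ }) ax-id

cut-shared : ∀ {Γ a Π} → Γ ▸ just a → (a ∷ Γ) ▸ Π → Γ ▸ Π
cut-shared p q = weaken-⊆ ++-idem-⊆ (cut p q)

#0 : ∀ {a} {Γ : List Fm} → (a ∷ Γ) ▸ just a
#0 = assumption (here refl)

#1 : ∀ {a b} {Γ : List Fm} → (b ∷ a ∷ Γ) ▸ just a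
#1 = assumption (there (here refl))

#2 : ∀ {a b c} {Γ : List Fm} → (c ∷ b ∷ a ∷ Γ) ▸ just a
#2 = assumption (there (there (here refl)))

#3 : ∀ {a b c d} {Γ : List Fm} → (d ∷ c ∷ b ∷ a ∷ Γ) ▸ just a
#3 = assumption (there (there (there (here refl))))

∧-elimˡ : ∀ {Γ a b} → Γ ▸ just (a ∧' b) → Γ ▸ just a
∧-elimˡ p = cut-shared p (∧-l₁ #0)

∧-elimʳ : ∀ {Γ a b} → Γ ▸ just (a ∧' b) → Γ ▸ just b
∧-elimʳ p = cut-shared p (∧-l₂ #0)

∨-elim : ∀ {Γ a b Π} → Γ ▸ just (a ∨' b) → (a ∷ Γ) ▸ Π → (b ∷ Γ) ▸ Π → Γ ▸ Π
∨-elim p q r = cut-shared p (∨-l q r)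

modus-ponens-▸ : ∀ {a Π} b → (b ∷ []) ▸ Π → ((a ⇒ b) ∷ a ∷ []) ▸ Π
modus-ponens-▸ _ q = ⇒-la {Γ = _ ∷ []} {Δ = []} ax-id q

⇒-elim-▸ : ∀ {Γ a b Π} → Γ ▸ just (a ⇒ b) → Γ ▸ just a → (b ∷ []) ▸ Π → Γ ▸ Π
⇒-elim-▸ {Γ} {a} {b} p q r =
  cut-shared p (cut-shared (w-l q) (weaken-⊆ swap (modus-ponens-▸ b r)))
  where
  swap : ((a ⇒ b) ∷ a ∷ []) ⊆ (a ∷ (a ⇒ b) ∷ Γ)
  swap (here refl)         = there (here refl)
  swap (there (here refl)) = here refl

⇒-elim : ∀ {Γ a b} → Γ ▸ just (a ⇒ b) → Γ ▸ just a → Γ ▸ just b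
⇒-elim p q = ⇒-elim-▸ p q ax-id

¬-elim : ∀ {Γ a} → Γ ▸ just (¬' a) → Γ ▸ just a → Γ ▸ nothing
¬-elim p q = ⇒-elim-▸ p q ax-0

⇒-intro : ∀ {Γ a b} → (a ∷ Γ) ▸ just b → (¬' a ∷ b ∷ Γ) ▸ nothing → Γ ▸ just (a ⇒ b)
⇒-intro p q = weaken-⊆ ++-idem-⊆ (⇒-r p q)

⇒-refute : ∀ {Γ a b} → (a ⇒ b) ∈ Γ → (¬' a ∷ Γ) ▸ just b → (a ∷ b ∷ Γ) ▸ nothing
         → Γ ▸ nothing
⇒-refute a⇒b∈Γ p q =
  weaken-⊆ (λ { (here refl) → a⇒b∈Γ ; (there m) → ++-idem-⊆ m }) (⇒-lb p q)

⇒-∧-self-▸-∧ : ∀ φ ψ → (((φ ⇒ ψ) ∧' φ) ∷ []) ▸ just (φ ∧' ψ)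
⇒-∧-self-▸-∧ φ ψ = ∧-r (∧-elimʳ #0) (⇒-elim (∧-elimˡ #0) (∧-elimʳ #0))

∧-▸-⇒-∧-self : ∀ φ ψ → ((φ ∧' ψ) ∷ []) ▸ just ((φ ⇒ ψ) ∧' φ)
∧-▸-⇒-∧-self φ ψ =
  ∧-r (⇒-intro (∧-elimʳ #1) (¬-elim #0 (∧-elimˡ #2))) (∧-elimˡ #0)

⇒-mono-∧ : ∀ φ ψ χ → ((φ ⇒ ψ) ∷ []) ▸ just ((φ ∧' χ) ⇒ (ψ ∧' χ))
⇒-mono-∧ φ ψ χ =
  ⇒-intro (∧-r (⇒-elim #1 (∧-elimˡ #0)) (∧-elimʳ #0))
          (⇒-refute (there (there (here refl)))
                    (∧-elimˡ #2)
                    (¬-elim #2 (∧-r #0 (∧-elimʳ #3))))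

⇒-mono-∨ : ∀ φ ψ χ → ((φ ⇒ ψ) ∷ []) ▸ just ((φ ∨' χ) ⇒ (ψ ∨' χ))
⇒-mono-∨ φ ψ χ =
  ⇒-intro (∨-elim #0 (∨-r₁ (⇒-elim #2 #0)) (∨-r₂ #0))
          (⇒-refute (there (there (here refl)))
                    (∨-elim #2 #0 (w-r (¬-elim #2 (∨-r₂ #0))))
                    (¬-elim #2 (∨-r₁ #0)))

lemma4p5 : (φ ψ χ : Fm)
    → (((((φ ⇒ ψ) ∧' φ) ∷ []) ▸ just (φ ∧' ψ))
       × (((φ ∧' ψ) ∷ []) ▸ just ((φ ⇒ ψ) ∧' φ)))
    × (((φ ⇒ ψ) ∷ []) ▸ just ((φ ∧' χ) ⇒ (ψ ∧' χ)))
    × (((φ ⇒ ψ) ∷ []) ▸ just ((φ ∨' χ) ⇒ (ψ ∨' χ)))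
lemma4p5 φ ψ χ =
  (⇒-∧-self-▸-∧ φ ψ , ∧-▸-⇒-∧-self φ ψ) , ⇒-mono-∧ φ ψ χ , ⇒-mono-∨ φ ψ χ
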